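{- Let $G$ be the cubic graph constructed below, and let $F$ be an even factor of $G$. If $F$ has a circuit component $C$ that passes through a non-terminal vertex of some copy $H'$ of the $2$-pole $H$ inside $G$ but is not contained in $H'$, then $H'$ contains at least three odd components of $F$ different from $C$.
   Context: An \emph{even factor} of a graph is a spanning subgraph in which every vertex has even degree; in a cubic graph its components are circuits and isolated vertices; a component is \emph{odd} if it has an odd number of vertices. A \emph{$2$-pole} $(K,s,t)$ is a graph $K$ with two distinct vertices $s,t$ of degree one (terminals); the edges at them are terminal edges. Joining terminal edges of two disjoint $2$-poles means identifying the two terminal vertices and suppressing the resulting degree-$2$ vertex. Construction: Let $P$ be the $2$-pole obtained from the Petersen graph by subdividing one edge $uv$ with a new vertex $w$ and then splitting off $w$ (delete $w$ and attach a new degree-one terminal vertex to each of the two dangling edges), so $P$ has terminals $s,t$ adjacent to $u,v$ respectively. The $2$-pole $H$: take two copies $(P_1,s_1,t_1)$, $(P_2,s_2,t_2)$ of $P$, identify $s_1$ with $s_2$ and $t_1$ with $t_2$, and attach a new terminal edge (to a new degree-one vertex) at each of the two identified vertices; these two new degree-one vertices are the terminals of $H$. The $2$-pole $H_2$: take two copies of $H$ and join a terminal edge of the first to a terminal edge of the second; the two remaining terminals are the terminals of $H_2$. The graph $G$: take $K_4$ on $u_0,u_1,u_2,u_3$ and delete all edges incident with $u_0$; then for each $i\in\{1,2,3\}$ take a new copy of $H_2$ and identify one of its terminals with $u_0$ and the other with $u_i$. Thus $G$ is cubic and contains six copies of $H$. -}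

module Defs where

open import Data.Nat using (ℕ; zero; suc; _+_; _*_; _%_)
open import Data.Fin using (Fin; #_)
import Data.Fin as F
open import Data.Bool using (Bool; true; false; if_then_else_)
open import Data.List using (List; []; _∷_; _++_; map; concatMap; allFin; length)
open import Data.Nat.ListAction using (sum)
open import Data.List.Membership.Propositional using (_∈_)
open import Data.List.Relation.Unary.Unique.Propositional using (Unique)
open import Data.Product using (_×_; _,_; Σ; ∃; ∃-syntax)
open import Data.Sum using (_⊎_)
open import Relation.Binary.PropositionalEquality using (_≡_)
open import Relation.Nullary using (¬_)
open import Function.Bundles using (_⇔_)

-- The Petersen graph on Fin 10: outer cycle 0..4, spokes i–(i+5),
-- inner pentagram (5+i)–(5+((i+2) mod 5)).

petersenEdges : List (Fin 10 × Fin 10)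
petersenEdges =
  (# 0 , # 1) ∷ (# 1 , # 2) ∷ (# 2 , # 3) ∷ (# 3 , # 4) ∷ (# 4 , # 0) ∷
  (# 0 , # 5) ∷ (# 1 , # 6) ∷ (# 2 , # 7) ∷ (# 3 , # 8) ∷ (# 4 , # 9) ∷
  (# 5 , # 7) ∷ (# 7 , # 9) ∷ (# 9 , # 6) ∷ (# 6 , # 8) ∷ (# 8 , # 5) ∷ []

-- The 2-pole P: Petersen graph with the edge uv = (0,1) subdivided and
-- split off (Petersen is edge-transitive, so the choice of uv is immaterial).
petersenMinusUV : List (Fin 10 × Fin 10)
petersenMinusUV =
  (# 1 , # 2) ∷ (# 2 , # 3) ∷ (# 3 , # 4) ∷ (# 4 , # 0) ∷
  (# 0 , # 5) ∷ (# 1 , # 6) ∷ (# 2 , # 7) ∷ (# 3 , # 8) ∷ (# 4 , # 9) ∷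
  (# 5 , # 7) ∷ (# 7 , # 9) ∷ (# 9 , # 6) ∷ (# 6 , # 8) ∷ (# 8 , # 5) ∷ []

-- Non-terminal vertices of the 2-pole H:
--   pet c i : vertex i of the Petersen copy P_c (c ∈ {0,1});
--   sv      : the identified vertex s_1 = s_2 (adjacent to pet 0 0, pet 1 0);
--   tv      : the identified vertex t_1 = t_2 (adjacent to pet 0 1, pet 1 1).
-- The terminal edges of H are attached at sv and at tv.

data HV : Set where
  pet : Fin 2 → Fin 10 → HV
  sv  : HV
  tv  : HV

hEdges : List (HV × HV)
hEdges = concatMap (λ c →
           map (λ { (i , j) → (pet c i , pet c j) }) petersenMinusUV
           ++ (pet c (# 0) , sv) ∷ (pet c (# 1) , tv) ∷ [])
         (allFin 2)

allHV : List HV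
allHV = concatMap (λ c → map (pet c) (allFin 10)) (allFin 2) ++ sv ∷ tv ∷ []

-- Vertices of G:
--   u i        : u_0, …, u_3 of K_4;
--   hv j k x   : vertex x of the k-th copy of H (k ∈ {0,1}) inside the
--                j-th copy of H_2 (j ∈ {0,1,2}, attached to u_0 and u_{j+1}).
-- In H_2 copy j, the terminal edge of H-copy 0 at tv is joined with the
-- terminal edge of H-copy 1 at sv, giving the edge (hv j 0 tv , hv j 1 sv).
-- The remaining terminals of H_2 copy j are identified with u_0 (at
-- hv j 0 sv) and with u_{j+1} (at hv j 1 tv).

data V : Set where
  u  : Fin 4 → V
  hv : Fin 3 → Fin 2 → HV → V

gEdges : List (V × V)
gEdges =
  (u (# 1) , u (# 2)) ∷ (u (# 1) , u (# 3)) ∷ (u (# 2) , u (# 3)) ∷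
  concatMap (λ j →
      concatMap (λ k → map (λ { (x , y) → (hv j k x , hv j k y) }) hEdges) (allFin 2)
      ++ (hv j (# 0) tv , hv j (# 1) sv)
       ∷ (u (# 0) , hv j (# 0) sv)
       ∷ (u (F.suc j) , hv j (# 1) tv)
       ∷ [])
    (allFin 3)

allV : List V
allV = map u (allFin 4)
       ++ concatMap (λ j → concatMap (λ k → map (hv j k) allHV) (allFin 2)) (allFin 3)

Adj : V → V → Set
Adj x y = ((x , y) ∈ gEdges) ⊎ ((y , x) ∈ gEdges)

record Spanning : Set where
  field
    has   : V → V → Bool
    sym   : ∀ x y → has x y ≡ has y x
    sub   : ∀ x y → has x y ≡ true → Adj x y
open Spanning public

deg : Spanning → V → ℕ
deg F x = sum (map (λ y → if has F x y then 1 else 0) allV)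

IsEvenFactor : Spanning → Set
IsEvenFactor F = ∀ x → deg F x % 2 ≡ 0

data Reach (F : Spanning) : V → V → Set where
  here : ∀ {x} → Reach F x x
  step : ∀ {x y z} → has F x y ≡ true → Reach F y z → Reach F x z

CircuitComp : Spanning → V → Set
CircuitComp F x = ∀ y → Reach F x y → deg F y ≡ 2

OddComp : Spanning → V → Set
OddComp F x = Σ (List V) λ L → Unique L × (∀ y → (y ∈ L) ⇔ Reach F x y)
                               × (length L % 2 ≡ 1)

InH : Fin 3 → Fin 2 → V → Set
InH j k v = Σ HV λ h → v ≡ hv j k h

CompInH : Spanning → Fin 3 → Fin 2 → V → Set
CompInH F j k x = ∀ y → Reach F x y → InH j k y

-- Let P be one of the two Petersen copies in H'. Inside P − uv, the parity of the degree of
-- u (resp. v) says whether F uses the terminal edge of P at u (resp. v). An exhaustive check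
-- of the 2^14 edge sets of P − uv that are even at the other eight vertices shows: F uses
-- both terminal edges of P or neither, F has an odd component inside P, and it has two
-- such components if the terminal edges are unused. If both copies use their terminal
-- edges, then the identified vertices s and t each have two edges of F inside H', hence
-- none leaving it, so no component of F leaves H'; yet the component of x does. So one
-- copy yields two odd components and the other copy one; they lie in H', so none of them
-- is the component of x.
module Submission where

open import Defs
open import Data.Fin using (Fin)
open import Data.Product using (_×_; Σ; ∃-syntax)
open import Relation.Nullary using (¬_)

open import Data.Bool using (Bool; true; false; _xor_; if_then_else_)
import Data.Bool.Properties as Bool
open import Data.Empty using (⊥; ⊥-elim)
open import Data.Fin using (#_; zero; suc)
open import Data.Fin.Properties using (all?; any?)
import Data.Fin.Properties as Fin
open import Data.List
  using (List; []; _∷_; [_]; _++_; map; foldr; filter; filterᵇ; concatMap; deduplicate; length; zip)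
import Data.List.Properties as List
open import Data.List.Membership.Propositional using (_∈_; _∉_; find)
open import Data.List.Membership.Propositional.Properties using (∈-map⁺; ∈-map⁻; ∈-++⁻)
open import Data.List.Relation.Unary.All as All using (All; []; _∷_)
import Data.List.Relation.Unary.All.Properties as All
open import Data.List.Relation.Unary.Any as Any using (Any; here; there)
open import Data.List.Relation.Unary.Unique.Propositional using (Unique)
import Data.List.Relation.Unary.Unique.Propositional.Properties as Unique
open import Data.Nat using (ℕ; zero; suc; _+_; _%_)
import Data.Nat.Properties as ℕ
open import Data.Nat.DivMod using (%-distribˡ-+)
open import Data.Nat.ListAction using (sum)
open import Data.Product using (_,_; proj₁; proj₂; uncurry)
import Data.Product.Properties as Product
open import Data.Sum using (_⊎_; inj₁; inj₂)
open import Data.Unit using (⊤)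
open import Data.Vec as Vec using (Vec; toList; fromList; lookup; tabulate)
open import Data.Vec.Properties using (lookup∘tabulate; tabulate-cong)
open import Function using (_∘_)
open import Function.Bundles using (mk⇔)
open import Relation.Binary.Definitions using (DecidableEquality)
open import Relation.Binary.PropositionalEquality as ≡ using (_≡_; refl; cong; subst)
open import Relation.Nullary using (Dec; yes; no; does; map′; _×-dec_; _⊎-dec_; _→-dec_)
open import Relation.Nullary.Decidable using (from-yes; dec-true; dec-false)
open import Relation.Unary using (Decidable)

parity : List Bool → Bool
parity = foldr _xor_ false

parity-++ : ∀ xs ys → parity (xs ++ ys) ≡ parity xs xor parity ys
parity-++ []       ys = refl
parity-++ (x ∷ xs) ys = ≡.trans (cong (x xor_) (parity-++ xs ys)) (≡.sym (Bool.xor-assoc x _ _))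

false≢true : ¬ false ≡ true
false≢true ()

xor-≡false : ∀ {x y} → x xor y ≡ false → x ≡ y
xor-≡false {false} e = ≡.sym e
xor-≡false {true}  e = ≡.sym (Bool.not-injective e)

sum-indicator-% : ∀ {A : Set} (g : A → Bool) xs →
  sum (map (λ x → if g x then 1 else 0) xs) % 2 ≡ (if parity (map g xs) then 1 else 0)
sum-indicator-% g [] = refl
sum-indicator-% g (x ∷ xs) with g x
... | false = sum-indicator-% g xs
... | true  = ≡.trans (%-distribˡ-+ 1 (sum (map (λ x → if g x then 1 else 0) xs)) 2)
                      (≡.trans (cong (λ m → (1 + m) % 2) (sum-indicator-% g xs)) (shift (parity (map g xs))))
  where
  shift : ∀ b → (1 + (if b then 1 else 0)) % 2 ≡ (if true xor b then 1 else 0)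
  shift false = refl
  shift true  = refl

sum-map-filter : ∀ {A : Set} {P : A → Set} (P? : Decidable P) {f : A → ℕ} →
  (∀ {x} → ¬ P x → f x ≡ 0) → ∀ xs → sum (map f xs) ≡ sum (map f (filter P? xs))
sum-map-filter P? f0 [] = refl
sum-map-filter P? {f} f0 (x ∷ xs) with P? x
... | yes _  = cong (f x +_) (sum-map-filter P? f0 xs)
... | no ¬px = ≡.trans (cong (_+ sum (map f xs)) (f0 ¬px)) (sum-map-filter P? f0 xs)

module _ {F : Spanning} where

  Reach-snoc : ∀ {x y z} → Reach F x y → has F y z ≡ true → Reach F x z
  Reach-snoc here        e = step e here
  Reach-snoc (step e′ r) e = step e′ (Reach-snoc r e)

  Reach-trans : ∀ {x y z} → Reach F x y → Reach F y z → Reach F x z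
  Reach-trans here       r′ = r′
  Reach-trans (step e r) r′ = step e (Reach-trans r r′)

  Reach-sym : ∀ {x y} → Reach F x y → Reach F y x
  Reach-sym here               = here
  Reach-sym (step {x} {y} e r) = Reach-snoc (Reach-sym r) (≡.trans (sym F y x) e)

  Reach-closed : (P : V → Set) → (∀ {x z} → P x → has F x z ≡ true → P z) →
                 ∀ {x y} → P x → Reach F x y → P y
  Reach-closed P step-P px here       = px
  Reach-closed P step-P px (step e r) = Reach-closed P step-P (step-P px e) r

  odd-component : ∀ {S r} → Unique S → length S % 2 ≡ 1 →
    (∀ {x z} → x ∈ S → has F x z ≡ true → z ∈ S) → r ∈ S → All (Reach F r) S → OddComp F r
  odd-component {S} uniq odd closed r∈S reach =
    S , uniq , (λ y → mk⇔ (All.lookup reach) (Reach-closed (_∈ S) closed r∈S)) , odd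

_≟ᴴ_ : DecidableEquality HV
pet c i ≟ᴴ pet d n =
  map′ (λ { (refl , refl) → refl }) (λ { refl → refl , refl }) (c Fin.≟ d ×-dec i Fin.≟ n)
sv      ≟ᴴ sv      = yes refl
tv      ≟ᴴ tv      = yes refl
pet _ _ ≟ᴴ sv      = no λ ()
pet _ _ ≟ᴴ tv      = no λ ()
sv      ≟ᴴ pet _ _ = no λ ()
sv      ≟ᴴ tv      = no λ ()
tv      ≟ᴴ pet _ _ = no λ ()
tv      ≟ᴴ sv      = no λ ()

_≟ⱽ_ : DecidableEquality V
u a      ≟ⱽ u b         = map′ (cong u) (λ { refl → refl }) (a Fin.≟ b)
hv j k h ≟ⱽ hv j′ k′ h′ =
  map′ (λ { (refl , refl , refl) → refl }) (λ { refl → refl , refl , refl })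
       (j Fin.≟ j′ ×-dec k Fin.≟ k′ ×-dec h ≟ᴴ h′)
u _      ≟ⱽ hv _ _ _    = no λ ()
hv _ _ _ ≟ⱽ u _         = no λ ()

allHV? : {P : HV → Set} → (∀ h → Dec (P h)) → Dec (∀ h → P h)
allHV? P? =
  map′ (λ { (p , s , t) (pet c i) → p c i ; (p , s , t) sv → s ; (p , s , t) tv → t })
       (λ f → (λ c i → f (pet c i)) , f sv , f tv)
       (all? (λ c → all? λ i → P? (pet c i)) ×-dec P? sv ×-dec P? tv)

module _ where
  open import Data.List.Membership.DecPropositional _≟ⱽ_ using (_∈?_)

  record Neighbourhood (y : V) (N : List V) : Set where
    field
      adjacent-∈      : ∀ {z} → Adj y z → z ∈ N
      listed-in-order : filter (_∈? N) allV ≡ N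

  module _ {y N} (nb : Neighbourhood y N) {F : Spanning} where
    open Neighbourhood nb

    neighbour-∈ : ∀ {z} → has F y z ≡ true → z ∈ N
    neighbour-∈ e = adjacent-∈ (sub F y _ e)

    deg-≡-sum : deg F y ≡ sum (map (λ z → if has F y z then 1 else 0) N)
    deg-≡-sum = ≡.trans (sum-map-filter (_∈? N) non-neighbour allV)
                        (cong (λ L → sum (map (λ z → if has F y z then 1 else 0) L)) listed-in-order)
      where
      non-neighbour : ∀ {z} → z ∉ N → (if has F y z then 1 else 0) ≡ 0
      non-neighbour {z} z∉N with has F y z in e
      ... | true  = ⊥-elim (z∉N (neighbour-∈ e))
      ... | false = refl

    even-parity : IsEvenFactor F → parity (map (has F y) N) ≡ false
    even-parity even = indicator-≡0 (≡.trans (≡.sym (sum-indicator-% (has F y) N))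
                                           (≡.trans (cong (_% 2) (≡.sym deg-≡-sum)) (even y)))
      where
      indicator-≡0 : ∀ {b} → (if b then 1 else 0) ≡ 0 → b ≡ false
      indicator-≡0 {false} _ = refl

-- neighbours in P − uv, where u = 0 and v = 1
pNbrs : Fin 10 → List (Fin 10)
pNbrs = lookup table
  where
  open import Data.Vec using () renaming (_∷_ to _∷ᵛ_; [] to []ᵛ)
  table : Vec (List (Fin 10)) 10
  table = (# 4 ∷ # 5 ∷ [])       ∷ᵛ (# 2 ∷ # 6 ∷ [])       ∷ᵛ (# 1 ∷ # 3 ∷ # 7 ∷ []) ∷ᵛ
          (# 2 ∷ # 4 ∷ # 8 ∷ []) ∷ᵛ (# 0 ∷ # 3 ∷ # 9 ∷ []) ∷ᵛ (# 0 ∷ # 7 ∷ # 8 ∷ []) ∷ᵛ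
          (# 1 ∷ # 8 ∷ # 9 ∷ []) ∷ᵛ (# 2 ∷ # 5 ∷ # 9 ∷ []) ∷ᵛ (# 3 ∷ # 5 ∷ # 6 ∷ []) ∷ᵛ
          (# 4 ∷ # 6 ∷ # 7 ∷ []) ∷ᵛ []ᵛ

-- A view records, for each vertex i, which edges to pNbrs i are chosen. The terminal
-- edges are not recorded: in an even factor they are determined by the parity at u and v.
View : Set
View = Vec (List (Fin 10 × Bool)) 10

entries : (Fin 10 → Fin 10 → Bool) → Fin 10 → List (Fin 10 × Bool)
entries t i = map (λ n → n , t i n) (pNbrs i)

view : (Fin 10 → Fin 10 → Bool) → View
view t = tabulate (entries t)

EvenAt : View → Fin 10 → Set
EvenAt w i = parity (map proj₂ (lookup w i)) ≡ false

InternallyEven : View → Set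
InternallyEven w = ∀ (i : Fin 8) → EvenAt w (suc (suc i))

module _ where
  open import Data.List.Membership.DecPropositional (Fin._≟_ {10}) using (_∈?_; _∉?_)
  open import Data.List.Membership.DecPropositional (Product.≡-dec (Fin._≟_ {10}) (Fin._≟_ {10}))
    using () renaming (_∈?_ to _∈ᴱ?_)
  open import Data.List.Relation.Unary.Unique.DecPropositional (Fin._≟_ {10}) using (unique?)

  -- A piece is a vertex set of P − uv that no chosen edge leaves; its vertices being even
  -- inside P − uv excludes the terminal edges at u and v.
  Closed : View → List (Fin 10) → Set
  Closed w L = All (λ i → EvenAt w i × All (λ e → proj₂ e ≡ true → proj₁ e ∈ L) (lookup w i)) L

  AttachedTo : View → List (Fin 10) → List (Fin 10) → Set
  AttachedTo w seen []       = ⊤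
  AttachedTo w seen (y ∷ ys) =
    Any (λ e → proj₂ e ≡ true × proj₁ e ∈ seen) (lookup w y) × AttachedTo w (y ∷ seen) ys

  Connected : View → List (Fin 10) → Set
  Connected w []         = ⊥
  Connected w (r ∷ rest) = AttachedTo w [ r ] rest

  OddPiece : View → List (Fin 10) → Set
  OddPiece w L = Connected w L × Closed w L × Unique L × length L % 2 ≡ 1

  -- Abstract, like the census itself: outside this block, types mentioning a component
  -- must not be normalised, which would be very expensive.
  abstract
    grow : View → List (Fin 10) → List (Fin 10)
    grow w L = deduplicate Fin._≟_ (L ++ concatMap (λ i → map proj₁ (filterᵇ proj₂ (lookup w i))) L)

    component : View → Fin 10 → List (Fin 10)
    component w r = iterate-grow 9 [ r ]
      where
      iterate-grow : ℕ → List (Fin 10) → List (Fin 10)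
      iterate-grow zero    L = L
      iterate-grow (suc m) L = iterate-grow m (grow w L)

  Good : View → Set
  Good w = parity (map proj₂ (lookup w (# 0))) ≡ parity (map proj₂ (lookup w (# 1)))
    × Σ (Fin 10) λ r → OddPiece w (component w r)
        × (EvenAt w (# 0) → Σ (Fin 10) λ r′ →
             OddPiece w (component w r′) × All (_∉ component w r) (component w r′))

  evenAt? : ∀ w i → Dec (EvenAt w i)
  evenAt? w i = parity (map proj₂ (lookup w i)) Bool.≟ false

  attachedTo? : ∀ w seen ys → Dec (AttachedTo w seen ys)
  attachedTo? w seen []       = yes _
  attachedTo? w seen (y ∷ ys) =
    Any.any? (λ e → proj₂ e Bool.≟ true ×-dec proj₁ e ∈? seen) (lookup w y)
    ×-dec attachedTo? w (y ∷ seen) ys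

  oddPiece? : ∀ w L → Dec (OddPiece w L)
  oddPiece? w L = connected? L ×-dec closed? ×-dec unique? L ×-dec length L % 2 ℕ.≟ 1
    where
    connected? : ∀ L → Dec (Connected w L)
    connected? []         = no λ ()
    connected? (r ∷ rest) = attachedTo? w [ r ] rest
    closed? : Dec (Closed w L)
    closed? = All.all? (λ i → evenAt? w i ×-dec
                All.all? (λ e → proj₂ e Bool.≟ true →-dec proj₁ e ∈? L) (lookup w i)) L

  good? : ∀ w → Dec (Good w)
  good? w = parity (map proj₂ (lookup w (# 0))) Bool.≟ parity (map proj₂ (lookup w (# 1)))
    ×-dec any? (λ r → oddPiece? w (component w r)
      ×-dec (evenAt? w (# 0) →-dec any? λ r′ →
               oddPiece? w (component w r′) ×-dec All.all? (_∉? component w r) (component w r′)))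

  all-vectors? : ∀ {n} {P : Vec Bool n → Set} → (∀ v → Dec (P v)) → Dec (∀ v → P v)
  all-vectors? {zero}  P? = map′ (λ { p Vec.[] → p }) (λ f → f Vec.[]) (P? Vec.[])
  all-vectors? {suc n} P? =
    map′ (λ { (p , q) (true Vec.∷ v) → p v ; (p , q) (false Vec.∷ v) → q v })
         (λ f → (λ v → f (true Vec.∷ v)) , (λ v → f (false Vec.∷ v)))
         (all-vectors? (λ v → P? (true Vec.∷ v)) ×-dec all-vectors? (λ v → P? (false Vec.∷ v)))

  Joins : Fin 10 × Fin 10 → Fin 10 → Fin 10 → Set
  Joins (a , b) i n = (a ≡ i × b ≡ n) ⊎ (a ≡ n × b ≡ i)

  joins? : ∀ e i n → Dec (Joins e i n)
  joins? (a , b) i n = (a Fin.≟ i ×-dec b Fin.≟ n) ⊎-dec (a Fin.≟ n ×-dec b Fin.≟ i)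

  edgeValue : List ((Fin 10 × Fin 10) × Bool) → Fin 10 → Fin 10 → Bool
  edgeValue []             i n = false
  edgeValue ((e , x) ∷ es) i n = if does (joins? e i n) then x else edgeValue es i n

  configuration : Vec Bool 14 → Fin 10 → Fin 10 → Bool
  configuration bs = edgeValue (zip petersenMinusUV (toList bs))

  abstract
    census : ∀ bs → InternallyEven (view (configuration bs)) → Good (view (configuration bs))
    census = from-yes (all-vectors? λ bs →
      all? (λ i → evenAt? (view (configuration bs)) (suc (suc i))) →-dec good? (view (configuration bs)))

  pNbrs-adjacent : ∀ i → All (λ n → (i , n) ∈ petersenMinusUV ⊎ (n , i) ∈ petersenMinusUV) (pNbrs i)
  pNbrs-adjacent = from-yes (all? λ i →
    All.all? (λ n → (i , n) ∈ᴱ? petersenMinusUV ⊎-dec (n , i) ∈ᴱ? petersenMinusUV) (pNbrs i))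

  edgeValue-zip : ∀ {t} → (∀ a b → t a b ≡ t b a) → ∀ E {i n} → (i , n) ∈ E ⊎ (n , i) ∈ E →
                  edgeValue (zip E (map (uncurry t) E)) i n ≡ t i n
  edgeValue-zip t-sym [] (inj₁ ())
  edgeValue-zip t-sym [] (inj₂ ())
  edgeValue-zip {t} t-sym ((a , b) ∷ E) {i} {n} adj with joins? (a , b) i n
  ... | yes ab~in = ≡.trans (cong (if_then _ else _) (dec-true (joins? (a , b) i n) ab~in)) (value ab~in)
    where
    value : Joins (a , b) i n → t a b ≡ t i n
    value (inj₁ (refl , refl)) = refl
    value (inj₂ (refl , refl)) = t-sym a b
  ... | no ¬ab~in = ≡.trans (cong (if_then _ else _) (dec-false (joins? (a , b) i n) ¬ab~in))
                            (edgeValue-zip t-sym E (later adj))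
    where
    later : (i , n) ∈ (a , b) ∷ E ⊎ (n , i) ∈ (a , b) ∷ E → (i , n) ∈ E ⊎ (n , i) ∈ E
    later (inj₁ (here refl))  = ⊥-elim (¬ab~in (inj₁ (refl , refl)))
    later (inj₁ (there in-E)) = inj₁ in-E
    later (inj₂ (here refl))  = ⊥-elim (¬ab~in (inj₂ (refl , refl)))
    later (inj₂ (there in-E)) = inj₂ in-E

  abstract
    census-symmetric : ∀ t → (∀ a b → t a b ≡ t b a) → InternallyEven (view t) → Good (view t)
    census-symmetric t t-sym even =
      subst Good same (census bits (subst InternallyEven (≡.sym same) even))
      where
      bits : Vec Bool 14
      bits = fromList (map (uncurry t) petersenMinusUV)
      same : view (configuration bits) ≡ view t
      same = tabulate-cong λ i → List.map-cong-local
        (All.map (λ {n} adj → cong (n ,_) (edgeValue-zip t-sym petersenMinusUV adj)) (pNbrs-adjacent i))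

∈-view⁻ : ∀ {t i e} → e ∈ lookup (view t) i → proj₁ e ∈ pNbrs i × proj₂ e ≡ t i (proj₁ e)
∈-view⁻ {t} {i} {e} e∈ with ∈-map⁻ (λ n → n , t i n) (subst (e ∈_) (lookup∘tabulate (entries t) i) e∈)
... | n , n∈ , refl = n∈ , refl

∈-view⁺ : ∀ {t i n} → n ∈ pNbrs i → (n , t i n) ∈ lookup (view t) i
∈-view⁺ {t} {i} {n} n∈ = subst ((n , t i n) ∈_) (≡.sym (lookup∘tabulate (entries t) i)) (∈-map⁺ _ n∈)

parity-view : ∀ t i → parity (map proj₂ (lookup (view t) i)) ≡ parity (map (t i) (pNbrs i))
parity-view t i = ≡.trans (cong (parity ∘ map proj₂) (lookup∘tabulate (entries t) i))
                          (cong parity (≡.sym (List.map-∘ (pNbrs i))))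

terminalNbr : Fin 3 → Fin 2 → Fin 10 → List V
terminalNbr j k zero          = [ hv j k sv ]
terminalNbr j k (suc zero)    = [ hv j k tv ]
terminalNbr j k (suc (suc _)) = []

terminalNbr-parity : ∀ {j k} i (g : V → Bool) {z} → z ∈ terminalNbr j k i →
                     parity (map g (terminalNbr j k i)) ≡ g z
terminalNbr-parity zero       g (here refl) = Bool.xor-identityʳ _
terminalNbr-parity (suc zero) g (here refl) = Bool.xor-identityʳ _

-- the far ends of the terminal edges of the copy (j , k) of H at s and at t
outerS outerT : Fin 3 → Fin 2 → V
outerS j zero    = u (# 0)
outerS j (suc _) = hv j (# 0) tv
outerT j zero    = hv j (# 1) sv
outerT j (suc _) = u (suc j)

-- listed in the order of allV, as Neighbourhood requires
nbrs : Fin 3 → Fin 2 → HV → List V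
nbrs j k (pet c i) = map (hv j k ∘ pet c) (pNbrs i) ++ terminalNbr j k i
nbrs j k sv = outerS j k ∷ hv j k (pet (# 0) (# 0)) ∷ hv j k (pet (# 1) (# 0)) ∷ []
nbrs j k@zero    tv = hv j k (pet (# 0) (# 1)) ∷ hv j k (pet (# 1) (# 1)) ∷ outerT j k ∷ []
nbrs j k@(suc _) tv = outerT j k ∷ hv j k (pet (# 0) (# 1)) ∷ hv j k (pet (# 1) (# 1)) ∷ []

module _ where
  open import Data.List.Membership.DecPropositional _≟ⱽ_ using (_∈?_)

  ListedNbr : V → V → Set
  ListedNbr (u _)      z = ⊤
  ListedNbr (hv j k h) z = z ∈ nbrs j k h

  edges-listed : All (λ e → ListedNbr (proj₁ e) (proj₂ e) × ListedNbr (proj₂ e) (proj₁ e)) gEdges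
  edges-listed =
    from-yes (All.all? (λ e → listed? (proj₁ e) (proj₂ e) ×-dec listed? (proj₂ e) (proj₁ e)) gEdges)
    where
    listed? : ∀ y z → Dec (ListedNbr y z)
    listed? (u _)      z = yes _
    listed? (hv j k h) z = z ∈? nbrs j k h

  nbrs-neighbourhood : ∀ j k h → Neighbourhood (hv j k h) (nbrs j k h)
  nbrs-neighbourhood j k h = record { adjacent-∈ = adjacent-∈ ; listed-in-order = listed-in-order j k h }
    where
    adjacent-∈ : ∀ {z} → Adj (hv j k h) z → z ∈ nbrs j k h
    adjacent-∈ (inj₁ e) = proj₁ (All.lookup edges-listed e)
    adjacent-∈ (inj₂ e) = proj₂ (All.lookup edges-listed e)
    listed-in-order : ∀ j k h → filter (_∈? nbrs j k h) allV ≡ nbrs j k h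
    listed-in-order = from-yes (all? λ j → all? λ k → allHV? λ h →
      List.≡-dec _≟ⱽ_ (filter (_∈? nbrs j k h) allV) (nbrs j k h))

first-of-three : ∀ {x a b} → a ≡ true → b ≡ true → x xor (a xor (b xor false)) ≡ false → x ≡ false
first-of-three {false} _    _    _ = refl
first-of-three {true}  refl refl ()

last-of-three : ∀ {x a b} → a ≡ true → b ≡ true → a xor (b xor (x xor false)) ≡ false → x ≡ false
last-of-three {false} _    _    _ = refl
last-of-three {true}  refl refl ()

pet-nbr-inside : ∀ {j k c} i {z} → z ∈ nbrs j k (pet c i) → InH j k z
pet-nbr-inside {j} {k} {c} i z∈ with ∈-++⁻ (map (hv j k ∘ pet c) (pNbrs i)) z∈
... | inj₁ z∈P with ∈-map⁻ (hv j k ∘ pet c) z∈P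
...   | n , _ , z≡ = pet c n , z≡
pet-nbr-inside zero       z∈ | inj₂ (here z≡) = sv , z≡
pet-nbr-inside (suc zero) z∈ | inj₂ (here z≡) = tv , z≡

module _ {F : Spanning} {j : Fin 3} where

  s-nbr-inside : ∀ {k z} → let g = has F (hv j k sv) in
    g (hv j k (pet (# 0) (# 0))) ≡ true → g (hv j k (pet (# 1) (# 0))) ≡ true →
    parity (map g (nbrs j k sv)) ≡ false → z ∈ nbrs j k sv → g z ≡ true → InH j k z
  s-nbr-inside e₀ e₁ even (here refl) e with ≡.trans (≡.sym e) (first-of-three e₀ e₁ even)
  ... | ()
  s-nbr-inside e₀ e₁ even (there (here refl))         e = pet (# 0) (# 0) , refl
  s-nbr-inside e₀ e₁ even (there (there (here refl))) e = pet (# 1) (# 0) , refl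

  t-nbr-inside : ∀ {k z} → let g = has F (hv j k tv) in
    g (hv j k (pet (# 0) (# 1))) ≡ true → g (hv j k (pet (# 1) (# 1))) ≡ true →
    parity (map g (nbrs j k tv)) ≡ false → z ∈ nbrs j k tv → g z ≡ true → InH j k z
  t-nbr-inside {zero} e₀ e₁ even (here refl)                 e = pet (# 0) (# 1) , refl
  t-nbr-inside {zero} e₀ e₁ even (there (here refl))         e = pet (# 1) (# 1) , refl
  t-nbr-inside {zero} e₀ e₁ even (there (there (here refl))) e
    with ≡.trans (≡.sym e) (last-of-three e₀ e₁ even)
  ... | ()
  t-nbr-inside {suc _} e₀ e₁ even (here refl) e
    with ≡.trans (≡.sym e) (first-of-three e₀ e₁ even)
  ... | ()
  t-nbr-inside {suc _} e₀ e₁ even (there (here refl))         e = pet (# 0) (# 1) , refl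
  t-nbr-inside {suc _} e₀ e₁ even (there (there (here refl))) e = pet (# 1) (# 1) , refl

ThreeOddComponents : Spanning → Fin 3 → Fin 2 → V → Set
ThreeOddComponents F j k x = Σ V λ a → Σ V λ b → Σ V λ c →
  (InH j k a × InH j k b × InH j k c) ×
  (CompInH F j k a × CompInH F j k b × CompInH F j k c) ×
  (OddComp F a × OddComp F b × OddComp F c) ×
  (¬ Reach F a b × ¬ Reach F a c × ¬ Reach F b c) ×
  (¬ Reach F x a × ¬ Reach F x b × ¬ Reach F x c)

module _ (F : Spanning) (even : IsEvenFactor F) (j : Fin 3) (k : Fin 2) where

  F-nbr-∈ : ∀ h {z} → has F (hv j k h) z ≡ true → z ∈ nbrs j k h
  F-nbr-∈ h = neighbour-∈ (nbrs-neighbourhood j k h) {F}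

  nbrs-parity : ∀ h → parity (map (has F (hv j k h)) (nbrs j k h)) ≡ false
  nbrs-parity h = even-parity (nbrs-neighbourhood j k h) {F} even

  record OddComponentIn (c : Fin 2) : Set where
    field
      root   : V
      odd    : OddComp F root
      inside : ∀ {y} → Reach F root y → ∃[ n ] y ≡ hv j k (pet c n)
  open OddComponentIn

  module PetersenCopy (c : Fin 2) where
    emb : Fin 10 → V
    emb = hv j k ∘ pet c

    chosen : Fin 10 → Fin 10 → Bool
    chosen i n = has F (emb i) (emb n)

    w : View
    w = view chosen

    parity-terminal : ∀ i →
      parity (map proj₂ (lookup w i)) ≡ parity (map (has F (emb i)) (terminalNbr j k i))
    parity-terminal i = ≡.trans (parity-view chosen i) (xor-≡false (begin
      parity (map (chosen i) (pNbrs i)) xor parity (map g T) ≡⟨ cong (λ L → parity L xor parity (map g T))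
                                                                    (List.map-∘ (pNbrs i)) ⟩
      parity (map g P) xor parity (map g T)                  ≡⟨ ≡.sym (parity-++ (map g P) (map g T)) ⟩
      parity (map g P ++ map g T)                            ≡⟨ cong parity (≡.sym (List.map-++ g P T)) ⟩
      parity (map g (P ++ T))                                ≡⟨ nbrs-parity (pet c i) ⟩
      false                                                  ∎))
      where
      open ≡.≡-Reasoning
      g : V → Bool
      g = has F (emb i)
      P T : List V
      P = map emb (pNbrs i)
      T = terminalNbr j k i

    terminal-parity : ∀ i {z} → z ∈ terminalNbr j k i → parity (map proj₂ (lookup w i)) ≡ has F (emb i) z
    terminal-parity i z∈ = ≡.trans (parity-terminal i) (terminalNbr-parity i (has F (emb i)) z∈)

    good : Good w
    good = census-symmetric chosen (λ a b → sym F (emb a) (emb b)) (λ i → parity-terminal (suc (suc i)))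

    terminals-agree : has F (emb (# 0)) (hv j k sv) ≡ has F (emb (# 1)) (hv j k tv)
    terminals-agree = ≡.trans (≡.sym (terminal-parity (# 0) (here refl)))
                              (≡.trans (proj₁ good) (terminal-parity (# 1) (here refl)))

    chosen-edge : ∀ {y e} → e ∈ lookup w y → proj₂ e ≡ true → has F (emb (proj₁ e)) (emb y) ≡ true
    chosen-edge {y} {n , _} e∈ used =
      ≡.trans (sym F (emb n) (emb y)) (≡.trans (≡.sym (proj₂ (∈-view⁻ {chosen} {y} e∈))) used)

    closed-step : ∀ {L} → Closed w L → ∀ {x z} → x ∈ map emb L → has F x z ≡ true → z ∈ map emb L
    closed-step {L} closed {z = z} x∈ e with ∈-map⁻ emb x∈
    ... | i , i∈L , refl = leave (∈-++⁻ (map emb (pNbrs i)) (F-nbr-∈ (pet c i) e))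
      where
      leave : z ∈ map emb (pNbrs i) ⊎ z ∈ terminalNbr j k i → z ∈ map emb L
      leave (inj₁ z∈) with ∈-map⁻ emb z∈
      ... | n , n∈ , refl =
        ∈-map⁺ emb (All.lookup (proj₂ (All.lookup closed i∈L)) (∈-view⁺ {chosen} {i} n∈) e)
      leave (inj₂ z∈T) = ⊥-elim (false≢true
        (≡.trans (≡.sym (proj₁ (All.lookup closed i∈L))) (≡.trans (terminal-parity i z∈T) e)))

    piece-reach : ∀ {r rest} → Closed w (r ∷ rest) → ∀ {y} → Reach F (emb r) y → y ∈ map emb (r ∷ rest)
    piece-reach closed = Reach-closed (_∈ map emb _) (closed-step closed) (here refl)

    attached-reach : ∀ {r seen ys} → AttachedTo w seen ys → All (Reach F r ∘ emb) seen → All (Reach F r ∘ emb) ys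
    attached-reach {ys = []}     _             _          = []
    attached-reach {r} {ys = y ∷ ys} (link , rest) reach-seen =
      reach-y ∷ attached-reach rest (reach-y ∷ reach-seen)
      where
      reach-y : Reach F r (emb y)
      reach-y = let _ , e∈ , used , n∈seen = find link
                in Reach-snoc (All.lookup reach-seen n∈seen) (chosen-edge e∈ used)

    piece-component : ∀ {L} → OddPiece w L → OddComponentIn c
    piece-component {r ∷ rest} (connected , closed , unique , odd-length) = record
      { root   = emb r
      ; odd    = odd-component (Unique.map⁺ (λ { refl → refl }) unique)
                               (≡.trans (cong (_% 2) (List.length-map emb (r ∷ rest))) odd-length)
                               (closed-step closed) (here refl)
                               (All.map⁺ (here ∷ attached-reach connected (here ∷ [])))
      ; inside = λ r↝y → let n , _ , y≡ = ∈-map⁻ emb (piece-reach closed r↝y) in n , y≡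
      }

    pieces-apart : ∀ {L₁ L₂} (p₁ : OddPiece w L₁) (p₂ : OddPiece w L₂) → All (_∉ L₁) L₂ →
                   ¬ Reach F (root (piece-component p₁)) (root (piece-component p₂))
    pieces-apart {r₁ ∷ rest₁} {r₂ ∷ _} (_ , closed , _) _ (r₂∉L₁ ∷ _) r₁↝r₂ =
      let n , n∈ , r₂≡ = ∈-map⁻ emb (piece-reach closed r₁↝r₂)
      in r₂∉L₁ (subst (_∈ r₁ ∷ rest₁) (≡.sym (pet-injective r₂≡)) n∈)
      where
      pet-injective : ∀ {a b} → emb a ≡ emb b → a ≡ b
      pet-injective refl = refl

    some-odd-component : OddComponentIn c
    some-odd-component = let _ , p , _ = proj₂ good in piece-component p

    two-odd-components : has F (emb (# 0)) (hv j k sv) ≡ false →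
      Σ (OddComponentIn c) λ a → Σ (OddComponentIn c) λ b → ¬ Reach F (root a) (root b)
    two-odd-components unused =
      let _ , p , second = proj₂ good
          _ , p′ , apart = second (≡.trans (terminal-parity (# 0) (here refl)) unused)
      in piece-component p , piece-component p′ , pieces-apart p p′ apart

  open PetersenCopy public using (terminals-agree; some-odd-component; two-odd-components)

  component-inside : ∀ {c} (a : OddComponentIn c) {y} → Reach F (root a) y → InH j k y
  component-inside {c} a r = let n , y≡ = inside a r in pet c n , y≡

  copies-apart : ∀ {c d} → ¬ c ≡ d → (a : OddComponentIn c) (b : OddComponentIn d) →
                 ¬ Reach F (root a) (root b)
  copies-apart c≢d a b r with inside a r | inside b here
  ... | _ , refl | _ , b≡ = c≢d (copy-injective b≡)
    where
    copy-injective : ∀ {c d n m} → hv j k (pet c n) ≡ hv j k (pet d m) → c ≡ d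
    copy-injective refl = refl

  unreachable-from-escaping : ∀ {x c} → ¬ CompInH F j k x → (a : OddComponentIn c) → ¬ Reach F x (root a)
  unreachable-from-escaping x-escapes a x↝a =
    x-escapes λ _ x↝y → component-inside a (Reach-trans (Reach-sym x↝a) x↝y)

  three-odd-components : ∀ {x c d} → ¬ CompInH F j k x → ¬ c ≡ d →
    (a b : OddComponentIn c) → ¬ Reach F (root a) (root b) → OddComponentIn d → ThreeOddComponents F j k x
  three-odd-components x-escapes c≢d a b a≁b e =
    root a , root b , root e ,
    (component-inside a here , component-inside b here , component-inside e here) ,
    ((λ _ → component-inside a) , (λ _ → component-inside b) , (λ _ → component-inside e)) ,
    (odd a , odd b , odd e) ,
    (a≁b , copies-apart c≢d a e , copies-apart c≢d b e) ,
    (unreachable a , unreachable b , unreachable e)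
    where
    unreachable : ∀ {c} (a : OddComponentIn c) → ¬ Reach F _ (root a)
    unreachable = unreachable-from-escaping x-escapes

  H-closed : has F (hv j k (pet (# 0) (# 0))) (hv j k sv) ≡ true →
             has F (hv j k (pet (# 1) (# 0))) (hv j k sv) ≡ true →
             ∀ {y z} → InH j k y → has F y z ≡ true → InH j k z
  H-closed _     _     (pet c i , refl) e = pet-nbr-inside i (F-nbr-∈ (pet c i) e)
  H-closed used₀ used₁ (sv , refl)      e =
    s-nbr-inside {F} (≡.trans (sym F _ _) used₀) (≡.trans (sym F _ _) used₁) (nbrs-parity sv) (F-nbr-∈ sv e) e
  H-closed used₀ used₁ (tv , refl)      e =
    t-nbr-inside {F} (≡.trans (sym F _ _) (≡.trans (≡.sym (terminals-agree (# 0))) used₀))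
                 (≡.trans (sym F _ _) (≡.trans (≡.sym (terminals-agree (# 1))) used₁))
                 (nbrs-parity tv) (F-nbr-∈ tv e) e

lemma2 : (F : Spanning) → IsEvenFactor F →
    (j : Fin 3) (k : Fin 2) (x : V) →
    InH j k x → CircuitComp F x → (¬ CompInH F j k x) →
    Σ V λ a → Σ V λ b → Σ V λ c →
      (InH j k a × InH j k b × InH j k c) ×
      (CompInH F j k a × CompInH F j k b × CompInH F j k c) ×
      (OddComp F a × OddComp F b × OddComp F c) ×
      (¬ Reach F a b × ¬ Reach F a c × ¬ Reach F b c) ×
      (¬ Reach F x a × ¬ Reach F x b × ¬ Reach F x c)
lemma2 F even j k x x∈H _ x-escapes
  with has F (hv j k (pet (# 0) (# 0))) (hv j k sv) in used₀
     | has F (hv j k (pet (# 1) (# 0))) (hv j k sv) in used₁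
... | false | _ =
  let a , b , a≁b = two-odd-components F even j k (# 0) used₀
  in three-odd-components F even j k x-escapes (λ ()) a b a≁b (some-odd-component F even j k (# 1))
... | true | false =
  let a , b , a≁b = two-odd-components F even j k (# 1) used₁
  in three-odd-components F even j k x-escapes (λ ()) a b a≁b (some-odd-component F even j k (# 0))
... | true | true = ⊥-elim (x-escapes λ _ → Reach-closed (InH j k) (H-closed F even j k used₀ used₁) x∈H)
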